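{- Let $m$ and $n$ be natural numbers. Then for every $L_{(m,n)}$-graph $G$, $$\gamma'_s(G)\leq \frac{(mn+m+1)(m-mn)}{2}.$$
   Context: All graphs are finite, simple and undirected. For an edge $e=uv$, $N[e]$ denotes the set of edges of $G$ sharing at least one endpoint with $e$ (including $e$ itself). For a graph $G$ with at least one edge, a function $f:E(G)\to\{ -1,1\}$ is a signed edge domination function (SEDF) if $\sum_{e'\in N[e]}f(e')\geq 1$ for every $e\in E(G)$. The signed edge domination number is $\gamma'_s(G)=\min\{\sum_{e\in E(G)}f(e) : f \text{ is an SEDF of } G\}$. An $L_{(m,n)}$-graph is a graph $G$ of order $(n+1)(mn+m+1)$ whose vertex set can be partitioned into $n+1$ sets $V_1,\dots,V_{n+1}$, each of size $mn+m+1$, such that: (i) the induced subgraph on $V_1$ is the complete graph $K_{mn+m+1}$; (ii) for $2\leq i\leq n+1$, $V_i$ is an independent set; (iii) for every $2\leq i\leq n+1$, the set of edges between $V_1$ and $V_i$ is the union of $m$ pairwise edge-disjoint perfect matchings between $V_1$ and $V_i$ (each of size $mn+m+1$); (iv) there is no edge between $V_i$ and $V_j$ for $2\leq i<j\leq n+1$. -}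

module Defs where

open import Data.Bool using (Bool; true; false; if_then_else_; _∧_; _∨_)
open import Data.Nat using (ℕ; zero; suc; _<ᵇ_)
import Data.Nat as ℕ
open import Data.Fin using (Fin; toℕ; zero; suc)
import Data.Fin as F
open import Data.Fin.Properties using (all?)
open import Data.Fin.Permutation using (Permutation′; _⟨$⟩ʳ_)
open import Data.Integer using (ℤ; +_; -[1+_]; _+_; _≤_; _≤?_; _⊓_)
open import Data.List using (List; []; _∷_; map; foldr; filter; filterᵇ; allFin; cartesianProduct; length; lookup; _++_)
open import Data.Product using (_×_; _,_; proj₁; proj₂; ∃)
open import Relation.Nullary using (¬_; ⌊_⌋)
open import Relation.Binary.PropositionalEquality using (_≡_)

record Graph (N : ℕ) : Set where
  field
    adj     : Fin N → Fin N → Bool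
    adj-sym : ∀ i j → adj i j ≡ adj j i
    irrefl  : ∀ i → adj i i ≡ false

module _ {N : ℕ} (G : Graph N) where
  open Graph G

  edgeList : List (Fin N × Fin N)
  edgeList = filterᵇ (λ p → (toℕ (proj₁ p) <ᵇ toℕ (proj₂ p)) ∧ adj (proj₁ p) (proj₂ p))
                     (cartesianProduct (allFin N) (allFin N))

  ‖E‖ : ℕ
  ‖E‖ = length edgeList

  edge : Fin ‖E‖ → Fin N × Fin N
  edge = lookup edgeList

  _=ᵥ_ : Fin N → Fin N → Bool
  i =ᵥ j = ⌊ i F.≟ j ⌋

  closedNbr : Fin ‖E‖ → Fin ‖E‖ → Bool
  closedNbr k l with edge k | edge l
  ... | (a , b) | (c , d) = (a =ᵥ c) ∨ (a =ᵥ d) ∨ (b =ᵥ c) ∨ (b =ᵥ d)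

Σℤ : (k : ℕ) → (Fin k → ℤ) → ℤ
Σℤ zero    g = + 0
Σℤ (suc k) g = g zero + Σℤ k (λ i → g (suc i))

-- A function E(G) → {-1, 1} is encoded as Fin ‖E‖ → Bool
-- (true ↦ 1, false ↦ -1).
±1 : Bool → ℤ
±1 true  = + 1
±1 false = -[1+ 0 ]

EdgeSigning : {N : ℕ} → Graph N → Set
EdgeSigning G = Fin (‖E‖ G) → Bool

module _ {N : ℕ} (G : Graph N) where

  nbrSum : EdgeSigning G → Fin (‖E‖ G) → ℤ
  nbrSum f k = Σℤ (‖E‖ G) (λ l → if closedNbr G k l then ±1 (f l) else + 0)

  IsSEDF : EdgeSigning G → Set
  IsSEDF f = ∀ k → + 1 ≤ nbrSum f k

  weight : EdgeSigning G → ℤ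
  weight f = Σℤ (‖E‖ G) (λ l → ±1 (f l))

allSignings : (k : ℕ) → List (Fin k → Bool)
allSignings zero    = (λ ()) ∷ []
allSignings (suc k) =
  map (λ g → λ { zero → true  ; (suc i) → g i }) (allSignings k) ++
  map (λ g → λ { zero → false ; (suc i) → g i }) (allSignings k)

module _ {N : ℕ} (G : Graph N) where

  sedfs : List (EdgeSigning G)
  sedfs = filter (λ f → all? (λ k → + 1 ≤? nbrSum G f k)) (allSignings (‖E‖ G))

  -- The constant-1 function is always an SEDF (every N[e] contains e),
  -- so its weight is used as the start value of the fold; the result is
  -- exactly the minimum over all SEDFs.
  γ's : ℤ
  γ's = foldr _⊓_ (weight G (λ _ → true)) (map (weight G) sedfs)

-- Order (n+1)(mn+m+1); the vertex partition V_1,…,V_{n+1}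
-- is given by a bijection  part : Fin (n+1) × Fin s ≅ Fin N  (s = mn+m+1),
-- block index zero standing for V_1.  For each 2 ≤ i ≤ n+1 the m matchings
-- between V_1 and V_i are perfect matchings, each given by a permutation σ of
-- Fin s (pairing part(0,a) with part(i,σ a)).

blockSize : ℕ → ℕ → ℕ
blockSize m n = m ℕ.* n ℕ.+ m ℕ.+ 1

record IsLGraph (m n : ℕ) {N : ℕ} (G : Graph N) : Set where
  open Graph G
  s = blockSize m n
  field
    order      : N ≡ suc n ℕ.* s
    part       : Fin (suc n) → Fin s → Fin N
    part-inj   : ∀ i a j b → part i a ≡ part j b → (i ≡ j × a ≡ b)
    part-surj  : ∀ v → ∃ λ i → ∃ λ a → part i a ≡ v
    complete   : ∀ a b → ¬ a ≡ b → adj (part zero a) (part zero b) ≡ true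
    indep      : ∀ (i : Fin n) a b → adj (part (suc i) a) (part (suc i) b) ≡ false
    matching   : Fin n → Fin m → Permutation′ s
    disjoint   : ∀ i k k' → ¬ k ≡ k' → ∀ a → ¬ (matching i k ⟨$⟩ʳ a ≡ matching i k' ⟨$⟩ʳ a)
    cross      : ∀ i a b → adj (part zero a) (part (suc i) b) ≡ true
                             → ∃ λ k → matching i k ⟨$⟩ʳ a ≡ b
    cross'     : ∀ i k a → adj (part zero a) (part (suc i) (matching i k ⟨$⟩ʳ a)) ≡ true
    noEdge     : ∀ (i j : Fin n) → ¬ i ≡ j → ∀ a b → adj (part (suc i) a) (part (suc j) b) ≡ false

module Submission where

-- Let s = mn+m+1 and sign an edge +1 if both ends lie in V₁, -1 otherwise.
-- For a symmetric weight W on vertex pairs, the signed degree of x is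
-- d(x) = Σ_{y ~ x} W(x,y), and for every graph
--   (handshake)      2 · Σ_e W(e) = Σ_x d(x),
--   (neighbourhood)  Σ_{e' ∈ N[e]} W(e') = d(a) + d(b) - W(a,b)  for e = ab.
-- In an L_(m,n)-graph a vertex of V₁ has s-1 neighbours in V₁ and m in each
-- other block, so d = (s-1) - nm = m; any other vertex has exactly m
-- neighbours, all in V₁, so d = -m.  Every closed edge neighbourhood thus
-- sums to 2m-1 ≥ 1 (m ≥ 1 as V₁ contains an edge) or to m-m+1 = 1: the
-- signing is an SEDF, of weight (sm - nsm)/2, which bounds the minimum γ'_s.

open import Defs
open import Data.Bool using (Bool; true; false; if_then_else_; _∧_; _∨_; T; T?)
open import Data.Bool.Properties using (∧-comm; T-∧; T-≡)
open import Data.Nat using (ℕ; zero; suc; _<ᵇ_)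
import Data.Nat as ℕ
import Data.Nat.Properties as ℕ
open import Data.Fin using (Fin; zero; suc; toℕ; _≟_)
open import Data.Fin.Properties using (toℕ-injective; all?)
open import Data.Fin.Permutation using (Permutation′; _⟨$⟩ʳ_; _⟨$⟩ˡ_; inverseˡ; inverseʳ)
open import Data.Integer using (ℤ; +_; -1ℤ; _+_; _*_; -_; _-_; _≤_; _≤?_; +≤+; _⊓_)
open import Data.Integer.Properties
  using ( +-*-semiring; +-identityˡ; +-identityʳ; +-assoc; *-identityˡ; *-identityʳ; *-zeroˡ
        ; suc-*; *-distribʳ-+; pos-+; pos-*; ≤-reflexive; ≤-trans; i⊓j≤i; i⊓j≤j
        ; *-monoˡ-≤-nonNeg; module ≤-Reasoning )
open import Data.Integer.Tactic.RingSolver using (solve-∀)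
open import Algebra.Properties.Semiring.Sum +-*-semiring
  using (sum-syntax; sum-cong-≗; sum-replicate-zero; ∑-comm; ∑-distrib-+; *-distribˡ-sum; *-distribʳ-sum)
open import Data.List using (List; []; _∷_; map; foldr; filterᵇ; cartesianProduct; length; lookup; _++_; tabulate; allFin)
open import Data.List.Membership.Propositional using (_∈_)
open import Data.List.Membership.Propositional.Properties using (∈-filter⁻; ∈-filter⁺; ∈-lookup; ∈-map⁺; ∈-++⁺ˡ; ∈-++⁺ʳ)
open import Data.List.Relation.Unary.Any using (here; there)
open import Data.Product using (_×_; _,_; proj₁; proj₂; ∃)
open import Data.Empty using (⊥-elim)
open import Function.Bundles using (Equivalence)
open import Relation.Nullary using (¬_; ⌊_⌋; yes; no)
open import Relation.Binary.PropositionalEquality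
open import Relation.Binary.Definitions using (tri<; tri≈; tri>)

⟦_⟧ : Bool → ℤ
⟦ true ⟧  = + 1
⟦ false ⟧ = + 0

δ : ∀ {k} → Fin k → Fin k → ℤ
δ i j = ⟦ ⌊ i ≟ j ⌋ ⟧

if-as-bracket : ∀ (b : Bool) x → (if b then x else + 0) ≡ ⟦ b ⟧ * x
if-as-bracket true  x = sym (*-identityˡ x)
if-as-bracket false x = sym (*-zeroˡ x)

δ-equal : ∀ {k} {i j : Fin k} → i ≡ j → δ i j ≡ + 1
δ-equal {i = i} {j} i≡j with i ≟ j
... | yes _   = refl
... | no  i≢j = ⊥-elim (i≢j i≡j)

δ-distinct : ∀ {k} {i j : Fin k} → ¬ i ≡ j → δ i j ≡ + 0
δ-distinct {i = i} {j} i≢j with i ≟ j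
... | yes i≡j = ⊥-elim (i≢j i≡j)
... | no  _   = refl

δ-sym : ∀ {k} (i j : Fin k) → δ i j ≡ δ j i
δ-sym i j with i ≟ j
... | yes i≡j = sym (δ-equal (sym i≡j))
... | no  i≢j = sym (δ-distinct (λ j≡i → i≢j (sym j≡i)))

δ-suc : ∀ {k} (i j : Fin k) → δ (suc i) (suc j) ≡ δ i j
δ-suc i j with i ≟ j
... | yes _ = refl
... | no  _ = refl

Σℤ≡∑ : ∀ k (g : Fin k → ℤ) → Σℤ k g ≡ ∑[ i < k ] g i
Σℤ≡∑ zero    g = refl
Σℤ≡∑ (suc k) g = cong (_+_ (g zero)) (Σℤ≡∑ k (λ i → g (suc i)))

Σℤ-cong : ∀ k {u v : Fin k → ℤ} → (∀ i → u i ≡ v i) → Σℤ k u ≡ Σℤ k v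
Σℤ-cong k {u} {v} u≗v = trans (Σℤ≡∑ k u) (trans (sum-cong-≗ u≗v) (sym (Σℤ≡∑ k v)))

∑-const : ∀ k c → ∑[ i < k ] c ≡ + k * c
∑-const zero    c = refl
∑-const (suc k) c = begin
    c + ∑[ i < k ] c  ≡⟨ cong (_+_ c) (∑-const k c) ⟩
    c + + k * c       ≡⟨ sym (suc-* (+ k) c) ⟩
    + suc k * c       ∎
  where open ≡-Reasoning

∑-distrib-- : ∀ k (f g : Fin k → ℤ) → ∑[ i < k ] (f i - g i) ≡ ∑[ i < k ] f i - ∑[ i < k ] g i
∑-distrib-- zero    f g = refl
∑-distrib-- (suc k) f g = begin
    (f zero - g zero) + ∑[ i < k ] (f (suc i) - g (suc i))
  ≡⟨ cong (_+_ (f zero - g zero)) (∑-distrib-- k (λ i → f (suc i)) (λ i → g (suc i))) ⟩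
    (f zero - g zero) + (∑[ i < k ] f (suc i) - ∑[ i < k ] g (suc i))
  ≡⟨ regroup (f zero) (g zero) _ _ ⟩
    (f zero + ∑[ i < k ] f (suc i)) - (g zero + ∑[ i < k ] g (suc i))
  ∎
  where
  open ≡-Reasoning
  regroup : ∀ a b c d → (a - b) + (c - d) ≡ (a + c) - (b + d)
  regroup = solve-∀

∑-δ : ∀ k (i₀ : Fin k) (f : Fin k → ℤ) → ∑[ i < k ] (δ i₀ i * f i) ≡ f i₀
∑-δ (suc k) zero f = begin
    + 1 * f zero + ∑[ i < k ] (δ zero (suc i) * f (suc i))
  ≡⟨ cong₂ _+_ (*-identityˡ (f zero)) (sum-cong-≗ (λ i → *-zeroˡ (f (suc i)))) ⟩
    f zero + ∑[ i < k ] (+ 0)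
  ≡⟨ cong (_+_ (f zero)) (sum-replicate-zero k) ⟩
    f zero + + 0
  ≡⟨ +-identityʳ (f zero) ⟩
    f zero
  ∎
  where open ≡-Reasoning
∑-δ (suc k) (suc i₀) f = begin
    + 0 * f zero + ∑[ i < k ] (δ (suc i₀) (suc i) * f (suc i))
  ≡⟨ cong₂ _+_ (*-zeroˡ (f zero)) (sum-cong-≗ (λ i → cong (_* f (suc i)) (δ-suc i₀ i))) ⟩
    + 0 + ∑[ i < k ] (δ i₀ i * f (suc i))
  ≡⟨ +-identityˡ _ ⟩
    ∑[ i < k ] (δ i₀ i * f (suc i))
  ≡⟨ ∑-δ k i₀ (λ i → f (suc i)) ⟩
    f (suc i₀)
  ∎
  where open ≡-Reasoning

∑-δ-one : ∀ k (i₀ : Fin k) → ∑[ i < k ] δ i₀ i ≡ + 1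
∑-δ-one k i₀ = trans (sum-cong-≗ (λ i → sym (*-identityʳ (δ i₀ i)))) (∑-δ k i₀ (λ _ → + 1))

listSum : ∀ {A : Set} → (A → ℤ) → List A → ℤ
listSum h xs = ∑[ l < length xs ] h (lookup xs l)

listSum-++ : ∀ {A : Set} (h : A → ℤ) xs ys → listSum h (xs ++ ys) ≡ listSum h xs + listSum h ys
listSum-++ h []       ys = sym (+-identityˡ (listSum h ys))
listSum-++ h (x ∷ xs) ys = trans (cong (_+_ (h x)) (listSum-++ h xs ys)) (sym (+-assoc (h x) _ _))

listSum-map : ∀ {A B : Set} (h : B → ℤ) (f : A → B) xs → listSum h (map f xs) ≡ listSum (λ x → h (f x)) xs
listSum-map h f []       = refl
listSum-map h f (x ∷ xs) = cong (_+_ (h (f x))) (listSum-map h f xs)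

listSum-filter : ∀ {A : Set} (h : A → ℤ) (p : A → Bool) xs →
                 listSum h (filterᵇ p xs) ≡ listSum (λ x → ⟦ p x ⟧ * h x) xs
listSum-filter h p []       = refl
listSum-filter h p (x ∷ xs) with p x
... | true  = cong₂ _+_ (sym (*-identityˡ (h x))) (listSum-filter h p xs)
... | false = begin
    listSum h (filterᵇ p xs)                          ≡⟨ listSum-filter h p xs ⟩
    listSum (λ y → ⟦ p y ⟧ * h y) xs                  ≡⟨ sym (+-identityˡ _) ⟩
    + 0 + listSum (λ y → ⟦ p y ⟧ * h y) xs            ≡⟨ cong (_+ listSum (λ y → ⟦ p y ⟧ * h y) xs) (sym (*-zeroˡ (h x))) ⟩
    + 0 * h x + listSum (λ y → ⟦ p y ⟧ * h y) xs      ∎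
  where open ≡-Reasoning

listSum-cartesian : ∀ {A B : Set} (h : A × B → ℤ) xs ys →
  listSum h (cartesianProduct xs ys) ≡ listSum (λ x → listSum (λ y → h (x , y)) ys) xs
listSum-cartesian h []       ys = refl
listSum-cartesian h (x ∷ xs) ys = begin
    listSum h (map (x ,_) ys ++ cartesianProduct xs ys)
  ≡⟨ listSum-++ h (map (x ,_) ys) (cartesianProduct xs ys) ⟩
    listSum h (map (x ,_) ys) + listSum h (cartesianProduct xs ys)
  ≡⟨ cong₂ _+_ (listSum-map h (x ,_) ys) (listSum-cartesian h xs ys) ⟩
    listSum (λ y → h (x , y)) ys + listSum (λ x′ → listSum (λ y → h (x′ , y)) ys) xs
  ∎
  where open ≡-Reasoning

listSum-tabulate : ∀ {A : Set} (h : A → ℤ) k (f : Fin k → A) → listSum h (tabulate f) ≡ ∑[ i < k ] h (f i)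
listSum-tabulate h zero    f = refl
listSum-tabulate h (suc k) f = cong (_+_ (h (f zero))) (listSum-tabulate h k (λ i → f (suc i)))

listSum-allFin : ∀ k (h : Fin k → ℤ) → listSum h (allFin k) ≡ ∑[ i < k ] h i
listSum-allFin k h = listSum-tabulate h k (λ i → i)

-- Inclusion–exclusion for "the pairs a<b and c<d share an endpoint": the
-- orderings rule out every double count except (c,d) = (a,b).
shareEndpoint-incl-excl : ∀ {N} (a b c d : Fin N) → toℕ a ℕ.< toℕ b → toℕ c ℕ.< toℕ d →
  ⟦ ⌊ a ≟ c ⌋ ∨ ⌊ a ≟ d ⌋ ∨ ⌊ b ≟ c ⌋ ∨ ⌊ b ≟ d ⌋ ⟧
    ≡ (δ a c + δ a d) + (δ b c + δ b d) - δ a c * δ b d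
shareEndpoint-incl-excl a b c d a<b c<d with a ≟ c | a ≟ d | b ≟ c | b ≟ d
... | yes refl | yes refl | _        | _        = ⊥-elim (ℕ.<-irrefl refl c<d)
... | yes refl | no _     | yes refl | _        = ⊥-elim (ℕ.<-irrefl refl a<b)
... | yes refl | no _     | no _     | yes refl = refl
... | yes refl | no _     | no _     | no _     = refl
... | no _     | yes refl | yes refl | _        = ⊥-elim (ℕ.<-asym a<b c<d)
... | no _     | yes refl | no _     | yes refl = ⊥-elim (ℕ.<-irrefl refl a<b)
... | no _     | yes refl | no _     | no _     = refl
... | no _     | no _     | yes refl | yes refl = ⊥-elim (ℕ.<-irrefl refl c<d)
... | no _     | no _     | yes refl | no _     = refl
... | no _     | no _     | no _     | yes refl = refl
... | no _     | no _     | no _     | no _     = refl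

SymmetricWeight : ∀ {N} → (Fin N → Fin N → ℤ) → Set
SymmetricWeight W = ∀ x y → W x y ≡ W y x

-- Sums over the edges of a graph, and the signed-degree identities.
module EdgeSums {N : ℕ} (G : Graph N) where
  open Graph G

  listed : Fin N → Fin N → Bool
  listed c d = (toℕ c <ᵇ toℕ d) ∧ adj c d

  tail head : Fin (‖E‖ G) → Fin N
  tail l = proj₁ (edge G l)
  head l = proj₂ (edge G l)

  ∑-edges : ∀ (h : Fin N → Fin N → ℤ) →
    ∑[ l < ‖E‖ G ] h (tail l) (head l) ≡ ∑[ c < N ] ∑[ d < N ] (⟦ listed c d ⟧ * h c d)
  ∑-edges h = begin
      listSum h′ (filterᵇ p (cartesianProduct (allFin N) (allFin N)))
    ≡⟨ listSum-filter h′ p (cartesianProduct (allFin N) (allFin N)) ⟩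
      listSum (λ q → ⟦ p q ⟧ * h′ q) (cartesianProduct (allFin N) (allFin N))
    ≡⟨ listSum-cartesian (λ q → ⟦ p q ⟧ * h′ q) (allFin N) (allFin N) ⟩
      listSum (λ c → listSum (λ d → ⟦ listed c d ⟧ * h c d) (allFin N)) (allFin N)
    ≡⟨ listSum-allFin N _ ⟩
      ∑[ c < N ] listSum (λ d → ⟦ listed c d ⟧ * h c d) (allFin N)
    ≡⟨ sum-cong-≗ (λ c → listSum-allFin N (λ d → ⟦ listed c d ⟧ * h c d)) ⟩
      ∑[ c < N ] ∑[ d < N ] (⟦ listed c d ⟧ * h c d)
    ∎
    where
    open ≡-Reasoning
    p : Fin N × Fin N → Bool
    p q = listed (proj₁ q) (proj₂ q)
    h′ : Fin N × Fin N → ℤ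
    h′ q = h (proj₁ q) (proj₂ q)

  edge-listed : ∀ l → T (listed (tail l) (head l))
  edge-listed l = proj₂ (∈-filter⁻ (λ q → T? (listed (proj₁ q) (proj₂ q)))
                                    {xs = cartesianProduct (allFin N) (allFin N)}
                                    (∈-lookup {xs = edgeList G} l))

  edge-ordered : ∀ l → toℕ (tail l) ℕ.< toℕ (head l)
  edge-ordered l = ℕ.<ᵇ⇒< (toℕ (tail l)) (toℕ (head l)) (proj₁ (Equivalence.to T-∧ (edge-listed l)))

  edge-adjacent : ∀ l → adj (tail l) (head l) ≡ true
  edge-adjacent l = Equivalence.to T-≡ (proj₂ (Equivalence.to T-∧ (edge-listed l)))

  adj-orientations : ∀ x y → ⟦ adj x y ⟧ ≡ ⟦ listed x y ⟧ + ⟦ listed y x ⟧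
  adj-orientations x y with toℕ x <ᵇ toℕ y in x<y | toℕ y <ᵇ toℕ x in y<x
  ... | true  | true  = ⊥-elim (ℕ.<-asym (from-<ᵇ x y x<y) (from-<ᵇ y x y<x))
    where
    from-<ᵇ : ∀ i j → (toℕ i <ᵇ toℕ j) ≡ true → toℕ i ℕ.< toℕ j
    from-<ᵇ i j e = ℕ.<ᵇ⇒< (toℕ i) (toℕ j) (subst T (sym e) _)
  ... | true  | false = sym (+-identityʳ ⟦ adj x y ⟧)
  ... | false | true  = trans (cong ⟦_⟧ (adj-sym x y)) (sym (+-identityˡ ⟦ adj y x ⟧))
  ... | false | false with ℕ.<-cmp (toℕ x) (toℕ y)
  ...   | tri< x<y′ _ _ = ⊥-elim (subst T x<y (ℕ.<⇒<ᵇ x<y′))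
  ...   | tri> _ _ y<x′ = ⊥-elim (subst T y<x (ℕ.<⇒<ᵇ y<x′))
  ...   | tri≈ _ x≡y _  rewrite toℕ-injective x≡y | irrefl y = refl

  signedDegree : (Fin N → Fin N → ℤ) → Fin N → ℤ
  signedDegree W x = ∑[ y < N ] (⟦ adj x y ⟧ * W x y)

  module _ (W : Fin N → Fin N → ℤ) (W-sym : SymmetricWeight W) where

    signedDegree-split : ∀ x → signedDegree W x
      ≡ ∑[ y < N ] (⟦ listed x y ⟧ * W x y) + ∑[ y < N ] (⟦ listed y x ⟧ * W y x)
    signedDegree-split x = trans (sum-cong-≗ split) (∑-distrib-+ (λ y → ⟦ listed x y ⟧ * W x y) (λ y → ⟦ listed y x ⟧ * W y x))
      where
      split : ∀ y → ⟦ adj x y ⟧ * W x y ≡ ⟦ listed x y ⟧ * W x y + ⟦ listed y x ⟧ * W y x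
      split y rewrite adj-orientations x y | W-sym y x = *-distribʳ-+ (W x y) ⟦ listed x y ⟧ _

    -- Handshake lemma: every edge contributes to the signed degrees of both ends.
    handshake : + 2 * ∑[ l < ‖E‖ G ] W (tail l) (head l) ≡ ∑[ x < N ] signedDegree W x
    handshake = begin
        + 2 * ∑[ l < ‖E‖ G ] W (tail l) (head l)
      ≡⟨ cong (+ 2 *_) (∑-edges W) ⟩
        + 2 * S
      ≡⟨ double S ⟩
        S + S
      ≡⟨ cong (_+_ S) (∑-comm (λ c d → ⟦ listed c d ⟧ * W c d)) ⟩
        S + ∑[ x < N ] ∑[ y < N ] (⟦ listed y x ⟧ * W y x)
      ≡⟨ sym (∑-distrib-+ (λ x → ∑[ y < N ] (⟦ listed x y ⟧ * W x y)) (λ x → ∑[ y < N ] (⟦ listed y x ⟧ * W y x))) ⟩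
        ∑[ x < N ] (∑[ y < N ] (⟦ listed x y ⟧ * W x y) + ∑[ y < N ] (⟦ listed y x ⟧ * W y x))
      ≡⟨ sym (sum-cong-≗ signedDegree-split) ⟩
        ∑[ x < N ] signedDegree W x
      ∎
      where
      open ≡-Reasoning
      S = ∑[ c < N ] ∑[ d < N ] (⟦ listed c d ⟧ * W c d)
      double : ∀ z → + 2 * z ≡ z + z
      double = solve-∀

    incident-sum : ∀ x → ∑[ l < ‖E‖ G ] ((δ x (tail l) + δ x (head l)) * W (tail l) (head l)) ≡ signedDegree W x
    incident-sum x = begin
        ∑[ l < ‖E‖ G ] ((δ x (tail l) + δ x (head l)) * W (tail l) (head l))
      ≡⟨ ∑-edges (λ c d → (δ x c + δ x d) * W c d) ⟩
        ∑[ c < N ] ∑[ d < N ] (⟦ listed c d ⟧ * ((δ x c + δ x d) * W c d))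
      ≡⟨ sum-cong-≗ (λ c → trans (sum-cong-≗ (λ d → expand (δ x c) (δ x d) ⟦ listed c d ⟧ (W c d)))
                                 (∑-distrib-+ (leaving c) (entering c))) ⟩
        ∑[ c < N ] (∑[ d < N ] leaving c d + ∑[ d < N ] entering c d)
      ≡⟨ ∑-distrib-+ (λ c → ∑[ d < N ] leaving c d) (λ c → ∑[ d < N ] entering c d) ⟩
        ∑[ c < N ] ∑[ d < N ] leaving c d + ∑[ c < N ] ∑[ d < N ] entering c d
      ≡⟨ cong₂ _+_ sift-leaving sift-entering ⟩
        ∑[ y < N ] (⟦ listed x y ⟧ * W x y) + ∑[ y < N ] (⟦ listed y x ⟧ * W y x)
      ≡⟨ sym (signedDegree-split x) ⟩
        signedDegree W x
      ∎
      where
      open ≡-Reasoning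
      leaving entering : Fin N → Fin N → ℤ
      leaving  c d = δ x c * (⟦ listed c d ⟧ * W c d)
      entering c d = δ x d * (⟦ listed c d ⟧ * W c d)
      expand : ∀ s t e w → e * ((s + t) * w) ≡ s * (e * w) + t * (e * w)
      expand = solve-∀
      sift-leaving : ∑[ c < N ] ∑[ d < N ] leaving c d ≡ ∑[ y < N ] (⟦ listed x y ⟧ * W x y)
      sift-leaving = trans (sum-cong-≗ (λ c → sym (*-distribˡ-sum (δ x c) (λ d → ⟦ listed c d ⟧ * W c d))))
                           (∑-δ N x (λ c → ∑[ d < N ] (⟦ listed c d ⟧ * W c d)))
      sift-entering : ∑[ c < N ] ∑[ d < N ] entering c d ≡ ∑[ y < N ] (⟦ listed y x ⟧ * W y x)
      sift-entering = trans (∑-comm entering)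
                      (trans (sum-cong-≗ (λ d → sym (*-distribˡ-sum (δ x d) (λ c → ⟦ listed c d ⟧ * W c d))))
                             (∑-δ N x (λ d → ∑[ c < N ] (⟦ listed c d ⟧ * W c d))))

    -- Only the edge ab itself has tail a and head b.
    edge-pair-sum : ∀ k → ∑[ l < ‖E‖ G ] (δ (tail k) (tail l) * δ (head k) (head l) * W (tail l) (head l))
                          ≡ W (tail k) (head k)
    edge-pair-sum k = begin
        ∑[ l < ‖E‖ G ] (δ a (tail l) * δ b (head l) * W (tail l) (head l))
      ≡⟨ ∑-edges (λ c d → δ a c * δ b d * W c d) ⟩
        ∑[ c < N ] ∑[ d < N ] (⟦ listed c d ⟧ * (δ a c * δ b d * W c d))
      ≡⟨ sum-cong-≗ (λ c → trans (sum-cong-≗ (λ d → reorder (δ a c) (δ b d) ⟦ listed c d ⟧ (W c d)))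
                                 (sym (*-distribˡ-sum (δ a c) (λ d → δ b d * (⟦ listed c d ⟧ * W c d))))) ⟩
        ∑[ c < N ] (δ a c * ∑[ d < N ] (δ b d * (⟦ listed c d ⟧ * W c d)))
      ≡⟨ ∑-δ N a _ ⟩
        ∑[ d < N ] (δ b d * (⟦ listed a d ⟧ * W a d))
      ≡⟨ ∑-δ N b _ ⟩
        ⟦ listed a b ⟧ * W a b
      ≡⟨ cong (λ t → ⟦ t ⟧ * W a b) (T-true (edge-listed k)) ⟩
        + 1 * W a b
      ≡⟨ *-identityˡ (W a b) ⟩
        W a b
      ∎
      where
      open ≡-Reasoning
      a = tail k
      b = head k
      reorder : ∀ s t e w → e * (s * t * w) ≡ s * (t * (e * w))
      reorder = solve-∀
      T-true : ∀ {β} → T β → β ≡ true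
      T-true {true} _ = refl

    neighbourhood-sum : ∀ k → ∑[ l < ‖E‖ G ] (⟦ closedNbr G k l ⟧ * W (tail l) (head l))
                              ≡ signedDegree W (tail k) + signedDegree W (head k) - W (tail k) (head k)
    neighbourhood-sum k = begin
        ∑[ l < ‖E‖ G ] (⟦ closedNbr G k l ⟧ * W (tail l) (head l))
      ≡⟨ sum-cong-≗ (λ l → trans (cong (_* W (tail l) (head l))
                                       (shareEndpoint-incl-excl a b (tail l) (head l) (edge-ordered k) (edge-ordered l)))
                                 (distribute (δ a (tail l)) (δ a (head l)) (δ b (tail l)) (δ b (head l)) (W (tail l) (head l)))) ⟩
        ∑[ l < ‖E‖ G ] ((inc a l + inc b l) - δ a (tail l) * δ b (head l) * W (tail l) (head l))
      ≡⟨ ∑-distrib-- (‖E‖ G) (λ l → inc a l + inc b l) _ ⟩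
        ∑[ l < ‖E‖ G ] (inc a l + inc b l) - ∑[ l < ‖E‖ G ] (δ a (tail l) * δ b (head l) * W (tail l) (head l))
      ≡⟨ cong₂ _-_ (trans (∑-distrib-+ (inc a) (inc b)) (cong₂ _+_ (incident-sum a) (incident-sum b)))
                   (edge-pair-sum k) ⟩
        signedDegree W a + signedDegree W b - W a b
      ∎
      where
      open ≡-Reasoning
      a = tail k
      b = head k
      inc : Fin N → Fin (‖E‖ G) → ℤ
      inc x l = (δ x (tail l) + δ x (head l)) * W (tail l) (head l)
      distribute : ∀ s t u v w → ((s + t) + (u + v) - s * v) * w ≡ ((s + t) * w + (u + v) * w) - s * v * w
      distribute = solve-∀

-- Reindexing sums along a partition of the vertices into k blocks of size
-- s, given by a bijection  part : Fin k × Fin s → Fin N  (curried).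
module Partition {N k s : ℕ} (part : Fin k → Fin s → Fin N)
  (part-inj  : ∀ i a j b → part i a ≡ part j b → (i ≡ j × a ≡ b))
  (part-surj : ∀ v → ∃ λ i → ∃ λ a → part i a ≡ v) where

  block : Fin N → Fin k
  block v = proj₁ (part-surj v)

  position : Fin N → Fin s
  position v = proj₁ (proj₂ (part-surj v))

  part-block-position : ∀ v → part (block v) (position v) ≡ v
  part-block-position v = proj₂ (proj₂ (part-surj v))

  block-part : ∀ i a → block (part i a) ≡ i
  block-part i a = proj₁ (part-inj _ _ _ _ (part-block-position (part i a)))

  same-position : ∀ v w → block v ≡ block w → position v ≡ position w → v ≡ w
  same-position v w b≡ p≡ = trans (sym (part-block-position v))
                                  (trans (cong₂ part b≡ p≡) (part-block-position w))

  δ-part : ∀ i a v → δ (part i a) v ≡ δ i (block v) * δ a (position v)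
  δ-part i a v with part i a ≟ v
  ... | yes e = let i≡ , a≡ = part-inj _ _ _ _ (trans e (sym (part-block-position v)))
                in sym (cong₂ _*_ (δ-equal i≡) (δ-equal a≡))
  ... | no part≢v with i ≟ block v | a ≟ position v
  ...   | yes refl | yes refl = ⊥-elim (part≢v (part-block-position v))
  ...   | yes _    | no _     = refl
  ...   | no _     | yes _    = refl
  ...   | no _     | no _     = refl

  preimage-count : ∀ v → ∑[ i < k ] ∑[ a < s ] δ (part i a) v ≡ + 1
  preimage-count v = begin
      ∑[ i < k ] ∑[ a < s ] δ (part i a) v
    ≡⟨ sum-cong-≗ (λ i → sum-cong-≗ (λ a → δ-part i a v)) ⟩
      ∑[ i < k ] ∑[ a < s ] (δ i (block v) * δ a (position v))
    ≡⟨ sum-cong-≗ (λ i → sym (*-distribˡ-sum (δ i (block v)) (λ a → δ a (position v)))) ⟩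
      ∑[ i < k ] (δ i (block v) * ∑[ a < s ] δ a (position v))
    ≡⟨ sum-cong-≗ (λ i → cong (δ i (block v) *_) (trans (sum-cong-≗ (λ a → δ-sym a (position v))) (∑-δ-one s (position v)))) ⟩
      ∑[ i < k ] (δ i (block v) * + 1)
    ≡⟨ sum-cong-≗ (λ i → *-identityʳ (δ i (block v))) ⟩
      ∑[ i < k ] δ i (block v)
    ≡⟨ trans (sum-cong-≗ (λ i → δ-sym i (block v))) (∑-δ-one k (block v)) ⟩
      + 1
    ∎
    where open ≡-Reasoning

  ∑-partition : ∀ (F : Fin N → ℤ) → ∑[ v < N ] F v ≡ ∑[ i < k ] ∑[ a < s ] F (part i a)
  ∑-partition F = begin
      ∑[ v < N ] F v
    ≡⟨ sum-cong-≗ (λ v → sym (trans (cong (_* F v) (preimage-count v)) (*-identityˡ (F v)))) ⟩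
      ∑[ v < N ] ((∑[ i < k ] ∑[ a < s ] δ (part i a) v) * F v)
    ≡⟨ sum-cong-≗ (λ v → trans (*-distribʳ-sum (F v) (λ i → ∑[ a < s ] δ (part i a) v))
                               (sum-cong-≗ (λ i → *-distribʳ-sum (F v) (λ a → δ (part i a) v)))) ⟩
      ∑[ v < N ] ∑[ i < k ] ∑[ a < s ] (δ (part i a) v * F v)
    ≡⟨ ∑-comm (λ v i → ∑[ a < s ] (δ (part i a) v * F v)) ⟩
      ∑[ i < k ] ∑[ v < N ] ∑[ a < s ] (δ (part i a) v * F v)
    ≡⟨ sum-cong-≗ (λ i → ∑-comm (λ v a → δ (part i a) v * F v)) ⟩
      ∑[ i < k ] ∑[ a < s ] ∑[ v < N ] (δ (part i a) v * F v)
    ≡⟨ sum-cong-≗ (λ i → sum-cong-≗ (λ a → ∑-δ N (part i a) F)) ⟩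
      ∑[ i < k ] ∑[ a < s ] F (part i a)
    ∎
    where open ≡-Reasoning

allSignings-complete : ∀ k (f : Fin k → Bool) → ∃ λ g → g ∈ allSignings k × (∀ i → g i ≡ f i)
allSignings-complete zero    f = _ , here refl , λ ()
allSignings-complete (suc k) f with allSignings-complete k (λ i → f (suc i)) | f zero in f₀
... | g , g∈ , g≗ | true  = _ , ∈-++⁺ˡ (∈-map⁺ _ g∈)   , λ { zero → sym f₀ ; (suc i) → g≗ i }
... | g , g∈ , g≗ | false = _ , ∈-++⁺ʳ _ (∈-map⁺ _ g∈) , λ { zero → sym f₀ ; (suc i) → g≗ i }

foldr-⊓-≤ : ∀ z (xs : List ℤ) {x} → x ∈ xs → foldr _⊓_ z xs ≤ x
foldr-⊓-≤ z (y ∷ ys) (here refl) = i⊓j≤i y _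
foldr-⊓-≤ z (y ∷ ys) (there x∈) = ≤-trans (i⊓j≤j y _) (foldr-⊓-≤ z ys x∈)

γ's≤weight : ∀ {N} (G : Graph N) (f : EdgeSigning G) → IsSEDF G f → γ's G ≤ weight G f
γ's≤weight G f f-sedf with allSignings-complete (‖E‖ G) f
... | g , g∈ , g≗f = subst (γ's G ≤_) same-weight (foldr-⊓-≤ _ _ (∈-map⁺ (weight G) g-sedf))
  where
  same-nbrSum : ∀ k → nbrSum G g k ≡ nbrSum G f k
  same-nbrSum k = Σℤ-cong (‖E‖ G) (λ l → cong (λ t → if closedNbr G k l then ±1 t else + 0) (g≗f l))
  same-weight : weight G g ≡ weight G f
  same-weight = Σℤ-cong (‖E‖ G) (λ l → cong ±1 (g≗f l))
  g-sedf : g ∈ sedfs G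
  g-sedf = ∈-filter⁺ (λ h → all? (λ k → + 1 ≤? nbrSum G h k)) g∈
                     (λ k → subst (+ 1 ≤_) (sym (same-nbrSum k)) (f-sedf k))

δ-permute : ∀ {s} (π : Permutation′ s) c b → δ (π ⟨$⟩ʳ c) b ≡ δ (π ⟨$⟩ˡ b) c
δ-permute π c b with (π ⟨$⟩ʳ c) ≟ b
... | yes πc≡b = sym (δ-equal (trans (cong (π ⟨$⟩ˡ_) (sym πc≡b)) (inverseˡ π)))
... | no  πc≢b = sym (δ-distinct (λ π⁻b≡c → πc≢b (trans (cong (π ⟨$⟩ʳ_) (sym π⁻b≡c)) (inverseʳ π))))

blockSize-ℤ : ∀ m n → + blockSize m n ≡ + m * + n + + m + + 1
blockSize-ℤ m n = begin
    + (m ℕ.* n ℕ.+ m ℕ.+ 1)     ≡⟨ pos-+ (m ℕ.* n ℕ.+ m) 1 ⟩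
    + (m ℕ.* n ℕ.+ m) + + 1     ≡⟨ cong (_+ + 1) (pos-+ (m ℕ.* n) m) ⟩
    + (m ℕ.* n) + + m + + 1     ≡⟨ cong (λ z → z + + m + + 1) (pos-* m n) ⟩
    + m * + n + + m + + 1       ∎
  where open ≡-Reasoning

distinct-in-block⇒m≥1 : ∀ m n (a b : Fin (blockSize m n)) → ¬ a ≡ b → ∃ λ k → m ≡ suc k
distinct-in-block⇒m≥1 zero    n zero zero a≢b = ⊥-elim (a≢b refl)
distinct-in-block⇒m≥1 (suc k) n a    b    _   = k , refl

-- The signing of an L_(m,n)-graph that is +1 exactly inside V₁, its signed
-- degrees, its closed-neighbourhood sums and its weight.
module LGraph (m n : ℕ) {N : ℕ} (G : Graph N) (L : IsLGraph m n G) where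
  open Graph G
  open IsLGraph L
  open EdgeSums G
  open Partition part part-inj part-surj

  isV₁ : Fin (suc n) → Bool
  isV₁ zero    = true
  isV₁ (suc _) = false

  inV₁ : Fin N → Bool
  inV₁ v = isV₁ (block v)

  W : Fin N → Fin N → ℤ
  W x y = ±1 (inV₁ x ∧ inV₁ y)

  W-sym : SymmetricWeight W
  W-sym x y = cong ±1 (∧-comm (inV₁ x) (inV₁ y))

  W-part : ∀ i a j c → W (part i a) (part j c) ≡ ±1 (isV₁ i ∧ isV₁ j)
  W-part i a j c = cong₂ (λ p q → ±1 (isV₁ p ∧ isV₁ q)) (block-part i a) (block-part j c)

  -- The k-th perfect matching between V₁ and V_{i+2}.
  σ : Fin n → Fin m → Fin s → Fin s
  σ i k a = matching i k ⟨$⟩ʳ a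

  -- Adjacency across V₁ and another block counts the matchings joining the
  -- two vertices; by edge-disjointness there is at most one.
  cross-adjacency : ∀ i a b → ⟦ adj (part zero a) (part (suc i) b) ⟧ ≡ ∑[ k < m ] δ (σ i k a) b
  cross-adjacency i a b with adj (part zero a) (part (suc i) b) in ab
  ... | true = let k₀ , σk₀a≡b = cross i a b ab in
      sym (trans (sum-cong-≗ (only k₀ σk₀a≡b)) (∑-δ-one m k₀))
    where
    only : ∀ k₀ → σ i k₀ a ≡ b → ∀ k → δ (σ i k a) b ≡ δ k₀ k
    only k₀ σk₀a≡b k with k ≟ k₀
    ... | yes refl = trans (δ-equal σk₀a≡b) (sym (δ-equal refl))
    ... | no  k≢k₀ = trans (δ-distinct (λ σka≡b → disjoint i k k₀ k≢k₀ a (trans σka≡b (sym σk₀a≡b))))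
                           (sym (δ-distinct (λ k₀≡k → k≢k₀ (sym k₀≡k))))
  ... | false = sym (trans (sum-cong-≗ none) (sum-replicate-zero m))
    where
    none : ∀ k → δ (σ i k a) b ≡ + 0
    none k = δ-distinct (λ σka≡b → true≢false (trans (sym (subst (λ z → adj (part zero a) (part (suc i) z) ≡ true) σka≡b (cross' i k a))) ab))
      where
      true≢false : ¬ true ≡ false
      true≢false ()

  V₁-neighbours-in-block : ∀ i a → ∑[ b < s ] ⟦ adj (part zero a) (part (suc i) b) ⟧ ≡ + m
  V₁-neighbours-in-block i a = begin
      ∑[ b < s ] ⟦ adj (part zero a) (part (suc i) b) ⟧   ≡⟨ sum-cong-≗ (cross-adjacency i a) ⟩
      ∑[ b < s ] ∑[ k < m ] δ (σ i k a) b                 ≡⟨ ∑-comm (λ b k → δ (σ i k a) b) ⟩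
      ∑[ k < m ] ∑[ b < s ] δ (σ i k a) b                 ≡⟨ sum-cong-≗ (λ k → ∑-δ-one s (σ i k a)) ⟩
      ∑[ k < m ] (+ 1)                                    ≡⟨ ∑-const m (+ 1) ⟩
      + m * + 1                                           ≡⟨ *-identityʳ (+ m) ⟩
      + m                                                 ∎
    where open ≡-Reasoning

  block-neighbours-in-V₁ : ∀ i b → ∑[ c < s ] ⟦ adj (part zero c) (part (suc i) b) ⟧ ≡ + m
  block-neighbours-in-V₁ i b = begin
      ∑[ c < s ] ⟦ adj (part zero c) (part (suc i) b) ⟧   ≡⟨ sum-cong-≗ (λ c → cross-adjacency i c b) ⟩
      ∑[ c < s ] ∑[ k < m ] δ (σ i k c) b                 ≡⟨ ∑-comm (λ c k → δ (σ i k c) b) ⟩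
      ∑[ k < m ] ∑[ c < s ] δ (σ i k c) b                 ≡⟨ sum-cong-≗ (λ k → sum-cong-≗ (λ c → δ-permute (matching i k) c b)) ⟩
      ∑[ k < m ] ∑[ c < s ] δ (matching i k ⟨$⟩ˡ b) c     ≡⟨ sum-cong-≗ (λ k → ∑-δ-one s (matching i k ⟨$⟩ˡ b)) ⟩
      ∑[ k < m ] (+ 1)                                    ≡⟨ ∑-const m (+ 1) ⟩
      + m * + 1                                           ≡⟨ *-identityʳ (+ m) ⟩
      + m                                                 ∎
    where open ≡-Reasoning

  V₁-neighbours-in-V₁ : ∀ a → ∑[ c < s ] ⟦ adj (part zero a) (part zero c) ⟧ ≡ + s - + 1
  V₁-neighbours-in-V₁ a = begin
      ∑[ c < s ] ⟦ adj (part zero a) (part zero c) ⟧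
    ≡⟨ sum-cong-≗ (λ c → sym (complement c)) ⟩
      ∑[ c < s ] (+ 1 - δ a c)
    ≡⟨ ∑-distrib-- s (λ _ → + 1) (δ a) ⟩
      ∑[ c < s ] (+ 1) - ∑[ c < s ] δ a c
    ≡⟨ cong₂ _-_ (trans (∑-const s (+ 1)) (*-identityʳ (+ s))) (∑-δ-one s a) ⟩
      + s - + 1
    ∎
    where
    open ≡-Reasoning
    complement : ∀ c → + 1 - δ a c ≡ ⟦ adj (part zero a) (part zero c) ⟧
    complement c with a ≟ c
    ... | yes refl rewrite irrefl (part zero a) = refl
    ... | no  a≢c  rewrite complete a c a≢c = refl

  outside-independent : ∀ i j b c → adj (part (suc i) b) (part (suc j) c) ≡ false
  outside-independent i j b c with i ≟ j
  ... | yes refl = indep i b c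
  ... | no  i≢j  = noEdge i j i≢j b c

  signedDegree-by-blocks : ∀ u → signedDegree W u ≡
      ∑[ c < s ] (⟦ adj u (part zero c) ⟧ * W u (part zero c))
    + ∑[ i < n ] ∑[ c < s ] (⟦ adj u (part (suc i) c) ⟧ * W u (part (suc i) c))
  signedDegree-by-blocks u = ∑-partition (λ y → ⟦ adj u y ⟧ * W u y)

  block-contribution : ∀ u j w → (∀ c → W u (part j c) ≡ w) →
    ∑[ c < s ] (⟦ adj u (part j c) ⟧ * W u (part j c)) ≡ (∑[ c < s ] ⟦ adj u (part j c) ⟧) * w
  block-contribution u j w W≡w = trans (sum-cong-≗ (λ c → cong (⟦ adj u (part j c) ⟧ *_) (W≡w c)))
                                       (sym (*-distribʳ-sum w (λ c → ⟦ adj u (part j c) ⟧)))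

  -- d(a) = (s-1) - nm = m for a vertex a of V₁.
  signedDegree-V₁ : ∀ a → signedDegree W (part zero a) ≡ + m
  signedDegree-V₁ a = begin
      signedDegree W u
    ≡⟨ signedDegree-by-blocks u ⟩
      ∑[ c < s ] (⟦ adj u (part zero c) ⟧ * W u (part zero c))
        + ∑[ i < n ] ∑[ c < s ] (⟦ adj u (part (suc i) c) ⟧ * W u (part (suc i) c))
    ≡⟨ cong₂ _+_ (block-contribution u zero (+ 1) (W-part zero a zero))
                 (sum-cong-≗ (λ i → block-contribution u (suc i) -1ℤ (W-part zero a (suc i)))) ⟩
      (∑[ c < s ] ⟦ adj u (part zero c) ⟧) * + 1 + ∑[ i < n ] ((∑[ c < s ] ⟦ adj u (part (suc i) c) ⟧) * -1ℤ)
    ≡⟨ cong₂ _+_ (cong (_* + 1) (V₁-neighbours-in-V₁ a))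
                 (trans (sum-cong-≗ (λ i → cong (_* -1ℤ) (V₁-neighbours-in-block i a))) (∑-const n (+ m * -1ℤ))) ⟩
      (+ s - + 1) * + 1 + + n * (+ m * -1ℤ)
    ≡⟨ cong (λ z → (z - + 1) * + 1 + + n * (+ m * -1ℤ)) (blockSize-ℤ m n) ⟩
      (+ m * + n + + m + + 1 - + 1) * + 1 + + n * (+ m * -1ℤ)
    ≡⟨ simplify (+ m) (+ n) ⟩
      + m
    ∎
    where
    open ≡-Reasoning
    u = part zero a
    simplify : ∀ x y → (x * y + x + + 1 - + 1) * + 1 + y * (x * -1ℤ) ≡ x
    simplify = solve-∀

  -- d(b) = -m for a vertex b outside V₁: its m neighbours all lie in V₁.
  signedDegree-outside : ∀ i b → signedDegree W (part (suc i) b) ≡ - + m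
  signedDegree-outside i b = begin
      signedDegree W v
    ≡⟨ signedDegree-by-blocks v ⟩
      ∑[ c < s ] (⟦ adj v (part zero c) ⟧ * W v (part zero c))
        + ∑[ j < n ] ∑[ c < s ] (⟦ adj v (part (suc j) c) ⟧ * W v (part (suc j) c))
    ≡⟨ cong₂ _+_ (block-contribution v zero -1ℤ (W-part (suc i) b zero))
                 (trans (sum-cong-≗ (λ j → trans (sum-cong-≗ (no-neighbour j)) (sum-replicate-zero s)))
                        (sum-replicate-zero n)) ⟩
      (∑[ c < s ] ⟦ adj v (part zero c) ⟧) * -1ℤ + + 0
    ≡⟨ cong (λ z → z * -1ℤ + + 0) (trans (sum-cong-≗ (λ c → cong ⟦_⟧ (adj-sym v (part zero c))))
                                           (block-neighbours-in-V₁ i b)) ⟩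
      + m * -1ℤ + + 0
    ≡⟨ simplify (+ m) ⟩
      - + m
    ∎
    where
    open ≡-Reasoning
    v = part (suc i) b
    no-neighbour : ∀ j c → ⟦ adj v (part (suc j) c) ⟧ * W v (part (suc j) c) ≡ + 0
    no-neighbour j c rewrite outside-independent i j b c = *-zeroˡ (W v (part (suc j) c))
    simplify : ∀ x → x * -1ℤ + + 0 ≡ - x
    simplify = solve-∀

  insideSigning : EdgeSigning G
  insideSigning l = inV₁ (tail l) ∧ inV₁ (head l)

  degreeOf : Bool → ℤ
  degreeOf true  = + m
  degreeOf false = - + m

  signedDegree-value : ∀ x → signedDegree W x ≡ degreeOf (inV₁ x)
  signedDegree-value x = trans (cong (signedDegree W) (sym (part-block-position x)))
                               (by-block (block x) (position x))
    where
    by-block : ∀ i a → signedDegree W (part i a) ≡ degreeOf (isV₁ i)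
    by-block zero    a = signedDegree-V₁ a
    by-block (suc i) a = signedDegree-outside i a

  nbrSum-value : ∀ k → nbrSum G insideSigning k
    ≡ degreeOf (inV₁ (tail k)) + degreeOf (inV₁ (head k)) - ±1 (inV₁ (tail k) ∧ inV₁ (head k))
  nbrSum-value k = begin
      nbrSum G insideSigning k
    ≡⟨ Σℤ≡∑ (‖E‖ G) _ ⟩
      ∑[ l < ‖E‖ G ] (if closedNbr G k l then W (tail l) (head l) else + 0)
    ≡⟨ sum-cong-≗ (λ l → if-as-bracket (closedNbr G k l) (W (tail l) (head l))) ⟩
      ∑[ l < ‖E‖ G ] (⟦ closedNbr G k l ⟧ * W (tail l) (head l))
    ≡⟨ neighbourhood-sum W W-sym k ⟩
      signedDegree W (tail k) + signedDegree W (head k) - W (tail k) (head k)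
    ≡⟨ cong₂ (λ p q → p + q - W (tail k) (head k)) (signedDegree-value (tail k)) (signedDegree-value (head k)) ⟩
      degreeOf (inV₁ (tail k)) + degreeOf (inV₁ (head k)) - ±1 (inV₁ (tail k) ∧ inV₁ (head k))
    ∎
    where open ≡-Reasoning

  outside-nonadjacent : ∀ x y → inV₁ x ≡ false → inV₁ y ≡ false → adj x y ≡ false
  outside-nonadjacent x y x∉V₁ y∉V₁ =
    subst₂ (λ p q → adj p q ≡ false) (part-block-position x) (part-block-position y)
           (by-block (block x) (block y) (position x) (position y) x∉V₁ y∉V₁)
    where
    by-block : ∀ i j a c → isV₁ i ≡ false → isV₁ j ≡ false → adj (part i a) (part j c) ≡ false
    by-block (suc i) (suc j) a c _ _ = outside-independent i j a c

  -- An edge inside V₁ joins two distinct vertices of V₁, so m ≥ 1.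
  edge-in-V₁⇒m≥1 : ∀ k → inV₁ (tail k) ≡ true → inV₁ (head k) ≡ true → ∃ λ j → m ≡ suc j
  edge-in-V₁⇒m≥1 k a∈V₁ b∈V₁ =
    distinct-in-block⇒m≥1 m n (position a) (position b) λ pos≡ →
      ℕ.<-irrefl (cong toℕ (same-position a b (trans (isV₁-zero a∈V₁) (sym (isV₁-zero b∈V₁))) pos≡))
                 (edge-ordered k)
    where
    a = tail k
    b = head k
    isV₁-zero : ∀ {i} → isV₁ i ≡ true → i ≡ zero
    isV₁-zero {zero} _ = refl

  insideSigning-isSEDF : IsSEDF G insideSigning
  insideSigning-isSEDF k = subst (+ 1 ≤_) (sym (nbrSum-value k)) (by-location (inV₁ (tail k)) (inV₁ (head k)) refl refl)
    where
    by-location : ∀ A B → inV₁ (tail k) ≡ A → inV₁ (head k) ≡ B → + 1 ≤ degreeOf A + degreeOf B - ±1 (A ∧ B)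
    by-location true  true  a∈V₁ b∈V₁ with edge-in-V₁⇒m≥1 k a∈V₁ b∈V₁
    ... | j , refl = subst (+ 1 ≤_) (twice-minus-one (+ j)) (+≤+ (ℕ.s≤s ℕ.z≤n))
      where
      twice-minus-one : ∀ x → + 1 + (x + x) ≡ (+ 1 + x) + (+ 1 + x) - + 1
      twice-minus-one = solve-∀
    by-location true  false _ _ = ≤-reflexive (sym (cancel (+ m)))
      where
      cancel : ∀ x → x + - x - -1ℤ ≡ + 1
      cancel = solve-∀
    by-location false true  _ _ = ≤-reflexive (sym (cancel (+ m)))
      where
      cancel : ∀ x → - x + x - -1ℤ ≡ + 1
      cancel = solve-∀
    by-location false false a∉V₁ b∉V₁ with trans (sym (edge-adjacent k)) (outside-nonadjacent (tail k) (head k) a∉V₁ b∉V₁)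
    ... | ()

  -- The weight of the signing: 2·w(f) = Σ_x d(x) = sm - nsm.
  insideSigning-weight : + 2 * weight G insideSigning ≡ + s * (+ m - + (m ℕ.* n))
  insideSigning-weight = begin
      + 2 * weight G insideSigning
    ≡⟨ cong (+ 2 *_) (Σℤ≡∑ (‖E‖ G) _) ⟩
      + 2 * ∑[ l < ‖E‖ G ] W (tail l) (head l)
    ≡⟨ handshake W W-sym ⟩
      ∑[ x < N ] signedDegree W x
    ≡⟨ ∑-partition (signedDegree W) ⟩
      ∑[ a < s ] signedDegree W (part zero a) + ∑[ i < n ] ∑[ a < s ] signedDegree W (part (suc i) a)
    ≡⟨ cong₂ _+_ (trans (sum-cong-≗ signedDegree-V₁) (∑-const s (+ m)))
                 (trans (sum-cong-≗ (λ i → trans (sum-cong-≗ (signedDegree-outside i)) (∑-const s (- + m))))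
                        (∑-const n (+ s * - + m))) ⟩
      + s * + m + + n * (+ s * - + m)
    ≡⟨ factor (+ s) (+ m) (+ n) ⟩
      + s * (+ m - + m * + n)
    ≡⟨ cong (λ z → + s * (+ m - z)) (sym (pos-* m n)) ⟩
      + s * (+ m - + (m ℕ.* n))
    ∎
    where
    open ≡-Reasoning
    factor : ∀ x y z → x * y + z * (x * - y) ≡ x * (y - y * z)
    factor = solve-∀

mainTheorem4 : (m n : ℕ) {N : ℕ} (G : Graph N) → IsLGraph m n G
             → + 2 * γ's G ≤ + blockSize m n * (+ m - + (m ℕ.* n))
mainTheorem4 m n G L = begin
    + 2 * γ's G
  ≤⟨ *-monoˡ-≤-nonNeg (+ 2) (γ's≤weight G insideSigning insideSigning-isSEDF) ⟩
    + 2 * weight G insideSigning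
  ≡⟨ insideSigning-weight ⟩
    + blockSize m n * (+ m - + (m ℕ.* n))
  ∎
  where
  open LGraph m n G L
  open ≤-Reasoning
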